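{- Let $X$ be a mixed unicyclic graph whose (unique) cycle has order $n$. Then $X$ is switching equivalent to a mixed unicyclic graph $Y$ with $G(Y)=G(X)$ such that one of the following holds: (i) all edges of $Y$ are undirected; (ii) the cycle of $Y$ is $C_n^{1}$ and all other edges of $Y$ are undirected; (iii) the cycle of $Y$ is $C_n^{2}$ and all other edges of $Y$ are undirected.
   Context: A mixed graph $X$ has undirected edges and directed edges (ordered pairs $(x,y)$); $G(X)$ is its underlying simple graph. $X$ is unicyclic if $G(X)$ is connected and has exactly one cycle. For vertices $v_1,\dots,v_n$, the Hermitian adjacency matrix $H(X)$ has $(j,k)$ entry $1$ if $v_jv_k$ is an undirected edge, $i$ if $(v_j,v_k)$ is a directed edge, $-i$ if $(v_k,v_j)$ is a directed edge, $0$ otherwise. $X,Y$ on the same vertex set are switching equivalent if $H(X)=D^{ -1}H(Y)D$ for a diagonal $D$ with diagonal entries in $\{\pm1,\pm i\}$. $C_n^1$ is the mixed cycle of order $n$ with exactly one directed edge, all others undirected; $C_n^2$ is the mixed cycle of order $n$ with two consecutive directed edges $(u,v),(v,w)$ with the same direction and all other edges undirected. -}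

module Defs where

open import Data.Nat using (ℕ; zero; suc; _≤_; _%_)
open import Data.Nat.DivMod using (m%n<n)
open import Data.Fin using (Fin; toℕ; fromℕ<)
open import Data.Bool using (Bool; true; false)
open import Data.Product using (Σ; ∃; _×_; _,_)
open import Data.Sum using (_⊎_)
open import Function.Definitions using (Injective)
open import Function.Bundles using (_⇔_)
open import Relation.Binary.PropositionalEquality using (_≡_)

-- Status of an ordered pair (j , k) of vertices in a mixed graph:
-- none = no edge; undir = undirected edge jk;
-- out = directed edge (j , k); into = directed edge (k , j).
data EdgeKind : Set where
  none undir out into : EdgeKind

flipKind : EdgeKind → EdgeKind
flipKind none  = none
flipKind undir = undir
flipKind out   = into
flipKind into  = out

isEdge : EdgeKind → Bool
isEdge none  = false
isEdge undir = true
isEdge out   = true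
isEdge into  = true

record MixedGraph (m : ℕ) : Set where
  field
    kind  : Fin m → Fin m → EdgeKind
    loopless : ∀ j → kind j j ≡ none
    consistent : ∀ j k → kind k j ≡ flipKind (kind j k)
open MixedGraph public

SimpleGraph : ℕ → Set
SimpleGraph m = Fin m → Fin m → Bool

G : ∀ {m} → MixedGraph m → SimpleGraph m
G X j k = isEdge (kind X j k)

data Reach {m} (g : SimpleGraph m) : Fin m → Fin m → Set where
  here : ∀ {j} → Reach g j j
  step : ∀ {j k l} → g j k ≡ true → Reach g k l → Reach g j l

Connected : ∀ {m} → SimpleGraph m → Set
Connected g = ∀ j k → Reach g j k

next : ∀ {n} → Fin n → Fin n
next {suc n} i = fromℕ< (m%n<n (suc (toℕ i)) (suc n))

record Cycle {m} (g : SimpleGraph m) (n : ℕ) : Set where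
  field
    order≥3 : 3 ≤ n
    vtx     : Fin n → Fin m
    vtx-inj : Injective _≡_ _≡_ vtx
    adj     : ∀ i → g (vtx i) (vtx (next i)) ≡ true
open Cycle public

OnEdge : ∀ {m} {g : SimpleGraph m} {n} → Cycle g n → Fin n → Fin m → Fin m → Set
OnEdge C i j k = (j ≡ vtx C i × k ≡ vtx C (next i)) ⊎ (k ≡ vtx C i × j ≡ vtx C (next i))

CycleEdge : ∀ {m} {g : SimpleGraph m} {n} → Cycle g n → Fin m → Fin m → Set
CycleEdge C j k = ∃ λ i → OnEdge C i j k

-- Unicyclic: connected with exactly one cycle (cycles identified by edge set).
Unicyclic : ∀ {m} → SimpleGraph m → Set
Unicyclic g = Connected g × (Σ ℕ λ n → Σ (Cycle g n) λ C →
  ∀ n' (C' : Cycle g n') → ∀ j k → (CycleEdge C j k ⇔ CycleEdge C' j k))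

data U4 : Set where
  one ii mone mii : U4

_·_ : U4 → U4 → U4
one  · b = b
ii   · one = ii
ii   · ii = mone
ii   · mone = mii
ii   · mii = one
mone · one = mone
mone · ii = mii
mone · mone = one
mone · mii = ii
mii  · one = mii
mii  · ii = one
mii  · mone = ii
mii  · mii = mone

inv : U4 → U4
inv one  = one
inv ii   = mii
inv mone = mone
inv mii  = ii

data Entry : Set where
  zero : Entry
  unit : U4 → Entry

sandwich : U4 → Entry → U4 → Entry
sandwich a zero     b = zero
sandwich a (unit u) b = unit ((a · u) · b)

H : ∀ {m} → MixedGraph m → Fin m → Fin m → Entry
H X j k with kind X j k
... | none  = zero
... | undir = unit one
... | out   = unit ii
... | into  = unit mii

SwitchingEquivalent : ∀ {m} → MixedGraph m → MixedGraph m → Set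
SwitchingEquivalent {m} X Y =
  Σ (Fin m → U4) λ d → ∀ j k → H X j k ≡ sandwich (inv (d j)) (H Y j k) (d k)

Directed : ∀ {m} → MixedGraph m → Fin m → Fin m → Set
Directed Y j k = (kind Y j k ≡ out) ⊎ (kind Y j k ≡ into)

-- Read each edge of X as a gain in the group {1, i, -1, -i} of fourth roots of unity
-- (its Hermitian entry). Deleting one edge A B of the cycle leaves a spanning tree T.
-- In a tree every closed walk has gain 1, so gains of walks from B define a potential d
-- with d k = d j · γ j k along T, and switching by d makes every tree edge undirected
-- while moving the whole gain W of the cycle onto A B. If W is 1, i or -i this is
-- case (i) or (ii). The entry -1 does not occur in a mixed graph, so for W = -1 the gain
-- of the tree edge B B₁ following B on the cycle is first twisted by -i; then A B and
-- B B₁ both receive i, which is case (iii).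

module Submission where

open import Defs
open import Level using (0ℓ)
open import Algebra.Bundles using (Group; AbelianGroup)
open import Algebra.Definitions
  using (Associative; Commutative; RightIdentity; LeftInverse; RightInverse)
open import Data.Bool using (true; false)
open import Data.Empty using (⊥; ⊥-elim)
open import Data.Fin using (Fin; zero; suc; toℕ; fromℕ; inject₁)
open import Data.Fin.Properties
  using ( toℕ-fromℕ<; toℕ-fromℕ; toℕ-inject₁; toℕ-injective; toℕ<n; any?
        ; fromℕ≢inject₁; suc-injective)
  renaming (_≟_ to _≟ᶠ_)
open import Data.Fin.Relation.Unary.Top using (view; ‵fromℕ; ‵inject₁)
open import Data.Nat as ℕ using (ℕ; zero; suc; _+_; _≤_; _%_; z≤n; s≤s)
open import Data.Nat.DivMod using (m<n⇒m%n≡m; n%n≡0)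
open import Data.Nat.Properties using (≤-refl; ≤-trans; n≤1+n; +-suc)
open import Data.Product using (Σ; ∃; _×_; _,_; proj₁)
open import Data.Sum using (_⊎_; inj₁; inj₂; swap)
open import Function using (_∘_)
open import Function.Bundles using (_⇔_; mk⇔; Equivalence)
open import Function.Definitions using (Injective)
open import Relation.Binary.Definitions using (DecidableEquality)
open import Relation.Binary.PropositionalEquality
  using (_≡_; _≢_; refl; sym; trans; cong; cong₂; subst; subst₂; isEquivalence; module ≡-Reasoning)
open import Relation.Nullary using (¬_; Dec; yes; no; map′)
open import Relation.Nullary.Decidable using (from-yes; _×-dec_; _⊎-dec_)
open import Relation.Unary using (Decidable)

code : U4 → ℕ
code one  = 0
code ii   = 1
code mone = 2
code mii  = 3

decode : ℕ → U4
decode 0 = one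
decode 1 = ii
decode 2 = mone
decode _ = mii

decode-code : ∀ u → decode (code u) ≡ u
decode-code one  = refl
decode-code ii   = refl
decode-code mone = refl
decode-code mii  = refl

infix 4 _≟ᵤ_
_≟ᵤ_ : DecidableEquality U4
u ≟ᵤ v = map′ code-injective (cong code) (code u ℕ.≟ code v)
  where
  code-injective : code u ≡ code v → u ≡ v
  code-injective eq = trans (sym (decode-code u)) (trans (cong decode eq) (decode-code v))

∀ᵤ? : ∀ {p} {P : U4 → Set p} → Decidable P → Dec (∀ u → P u)
∀ᵤ? P? = map′ (λ { (p₁ , p₂ , p₃ , p₄) → λ { one → p₁ ; ii → p₂ ; mone → p₃ ; mii → p₄ } })
              (λ ∀P → ∀P one , ∀P ii , ∀P mone , ∀P mii)
              (P? one ×-dec P? ii ×-dec P? mone ×-dec P? mii)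

·-assoc : Associative _≡_ _·_
·-assoc = from-yes (∀ᵤ? λ a → ∀ᵤ? λ b → ∀ᵤ? λ c → (a · b) · c ≟ᵤ a · (b · c))

·-comm : Commutative _≡_ _·_
·-comm = from-yes (∀ᵤ? λ a → ∀ᵤ? λ b → a · b ≟ᵤ b · a)

·-identityʳ : RightIdentity _≡_ one _·_
·-identityʳ = from-yes (∀ᵤ? λ a → a · one ≟ᵤ a)

inv-inverseˡ : LeftInverse _≡_ one inv _·_
inv-inverseˡ = from-yes (∀ᵤ? λ a → inv a · a ≟ᵤ one)

inv-inverseʳ : RightInverse _≡_ one inv _·_
inv-inverseʳ = from-yes (∀ᵤ? λ a → a · inv a ≟ᵤ one)

U4-abelianGroup : AbelianGroup 0ℓ 0ℓ
U4-abelianGroup = record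
  { Carrier = U4
  ; _≈_ = _≡_
  ; _∙_ = _·_
  ; ε = one
  ; _⁻¹ = inv
  ; isAbelianGroup = record
    { isGroup = record
      { isMonoid = record
        { isSemigroup = record
          { isMagma = record { isEquivalence = isEquivalence ; ∙-cong = cong₂ _·_ }
          ; assoc = ·-assoc
          }
        ; identity = (λ _ → refl) , ·-identityʳ
        }
      ; inverse = inv-inverseˡ , inv-inverseʳ
      ; ⁻¹-cong = cong inv
      }
    ; comm = ·-comm
    }
  }

open import Algebra.Properties.AbelianGroup U4-abelianGroup using (⁻¹-∙-comm)
open import Algebra.Properties.Group (AbelianGroup.group U4-abelianGroup)
  using (⁻¹-involutive; ⁻¹-injective)

Directional : U4 → Set
Directional u = u ≡ ii ⊎ u ≡ mii

Directional-inv : ∀ {u} → Directional u → Directional (inv u)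
Directional-inv (inj₁ refl) = inj₂ refl
Directional-inv (inj₂ refl) = inj₁ refl

¬Directional-one : ¬ Directional one
¬Directional-one (inj₁ ())
¬Directional-one (inj₂ ())

one≢mone : one ≢ mone
one≢mone ()

directional≢mone : ∀ {u} → Directional u → u ≢ mone
directional≢mone (inj₁ refl) ()
directional≢mone (inj₂ refl) ()

next-fromℕ : ∀ n → next (fromℕ n) ≡ zero
next-fromℕ n = toℕ-injective (begin
  toℕ (next (fromℕ n))         ≡⟨ toℕ-fromℕ< _ ⟩
  suc (toℕ (fromℕ n)) % suc n  ≡⟨ cong (λ t → suc t % suc n) (toℕ-fromℕ n) ⟩
  suc n % suc n                ≡⟨ n%n≡0 (suc n) ⟩
  0                            ∎)
  where open ≡-Reasoning

next-inject₁ : ∀ {n} (j : Fin n) → next (inject₁ j) ≡ suc j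
next-inject₁ {n} j = toℕ-injective (begin
  toℕ (next (inject₁ j))         ≡⟨ toℕ-fromℕ< _ ⟩
  suc (toℕ (inject₁ j)) % suc n  ≡⟨ cong (λ t → suc t % suc n) (toℕ-inject₁ j) ⟩
  suc (toℕ j) % suc n            ≡⟨ m<n⇒m%n≡m (s≤s (toℕ<n j)) ⟩
  suc (toℕ j)                    ∎)
  where open ≡-Reasoning

Symmetric : ∀ {m} → SimpleGraph m → Set
Symmetric g = ∀ j k → g j k ≡ g k j

Irreflexive : ∀ {m} → SimpleGraph m → Set
Irreflexive g = ∀ j → g j j ≡ false

Acyclic : ∀ {m} → SimpleGraph m → Set
Acyclic g = ∀ {n} → Cycle g n → ⊥

Cycle-mono : ∀ {m n} {g h : SimpleGraph m} → (∀ {j k} → g j k ≡ true → h j k ≡ true) →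
             Cycle g n → Cycle h n
Cycle-mono g⊆h C = record
  { order≥3 = order≥3 C ; vtx = vtx C ; vtx-inj = vtx-inj C ; adj = λ i → g⊆h (adj C i) }

module Walk {m} (g : SimpleGraph m) where

  private variable a b c x : Fin m

  infixr 5 _++_
  _++_ : Reach g a b → Reach g b c → Reach g a c
  here     ++ q = q
  step e p ++ q = step e (p ++ q)

  length : Reach g a c → ℕ
  length here       = 0
  length (step _ p) = suc (length p)

  length-++ : (p : Reach g a b) (q : Reach g b c) → length (p ++ q) ≡ length p + length q
  length-++ here       q = refl
  length-++ (step _ p) q = cong suc (length-++ p q)

  reverse : Symmetric g → Reach g a c → Reach g c a
  reverse g-sym here               = here
  reverse g-sym (step {j} {k} e p) = reverse g-sym p ++ step (trans (g-sym k j) e) here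

  vertex : (p : Reach g a c) → Fin (suc (length p)) → Fin m
  vertex (here {j})     zero    = j
  vertex (step {j} _ _) zero    = j
  vertex (step _ p)     (suc i) = vertex p i

  vertex-zero : (p : Reach g a c) → vertex p zero ≡ a
  vertex-zero here       = refl
  vertex-zero (step _ _) = refl

  vertex-last : (p : Reach g a c) → vertex p (fromℕ (length p)) ≡ c
  vertex-last here       = refl
  vertex-last (step _ p) = vertex-last p

  vertex-step : (p : Reach g a c) (i : Fin (length p)) →
                g (vertex p (inject₁ i)) (vertex p (suc i)) ≡ true
  vertex-step (step e p) zero    = subst (λ v → g _ v ≡ true) (sym (vertex-zero p)) e
  vertex-step (step _ p) (suc i) = vertex-step p i

  infix 4 _∈ᵥ_
  _∈ᵥ_ : Fin m → Reach g a c → Set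
  x ∈ᵥ p = ∃ λ i → vertex p i ≡ x

  _∈ᵥ?_ : ∀ x (p : Reach g a c) → Dec (x ∈ᵥ p)
  x ∈ᵥ? p = any? (λ i → vertex p i ≟ᶠ x)

  ∈ᵥ-++ˡ : (p : Reach g a b) (q : Reach g b c) → x ∈ᵥ p → x ∈ᵥ p ++ q
  ∈ᵥ-++ˡ here       q (zero , refl) = zero , vertex-zero q
  ∈ᵥ-++ˡ (step _ p) q (zero , eq)   = zero , eq
  ∈ᵥ-++ˡ (step _ p) q (suc i , eq)  = let i′ , eq′ = ∈ᵥ-++ˡ p q (i , eq) in suc i′ , eq′

  data Simple : Reach g a c → Set where
    here : Simple (here {j = a})
    step : {e : g a b ≡ true} {p : Reach g b c} → ¬ a ∈ᵥ p → Simple p → Simple (step e p)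

  Simple-injective : {p : Reach g a c} → Simple p → Injective _≡_ _≡_ (vertex p)
  Simple-injective here         {zero}  {zero}  _  = refl
  Simple-injective (step _ _)   {zero}  {zero}  _  = refl
  Simple-injective (step a∉p _) {zero}  {suc j} eq = ⊥-elim (a∉p (j , sym eq))
  Simple-injective (step a∉p _) {suc i} {zero}  eq = ⊥-elim (a∉p (i , eq))
  Simple-injective (step _ s)   {suc i} {suc j} eq = cong suc (Simple-injective s eq)

  Simple-++ˡ : (p : Reach g a b) (q : Reach g b c) → Simple (p ++ q) → Simple p
  Simple-++ˡ here       q _             = here
  Simple-++ˡ (step _ p) q (step a∉pq s) = step (a∉pq ∘ ∈ᵥ-++ˡ p q) (Simple-++ˡ p q s)

  splitAt : (p : Reach g a c) → x ∈ᵥ p → Σ (Reach g a x) λ s → Σ (Reach g x c) λ t → p ≡ s ++ t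
  splitAt here       (zero , refl) = here , here , refl
  splitAt (step e p) (zero , refl) = here , step e p , refl
  splitAt (step e p) (suc i , eq) with splitAt p (i , eq)
  ... | s , t , refl = step e s , t , refl

  record Loop (p : Reach g a c) : Set where
    constructor loop
    field
      {y z}         : Fin m
      before        : Reach g a y
      closing       : g y z ≡ true
      around        : Reach g z y
      after         : Reach g y c
      around-simple : Simple around
      decomposition : p ≡ before ++ step closing (around ++ after)

  simple-or-loop : (p : Reach g a c) → Simple p ⊎ Loop p
  simple-or-loop here = inj₁ here
  simple-or-loop (step {a} e p) with simple-or-loop p
  ... | inj₂ (loop p₁ e′ s p₂ s-simple refl) = inj₂ (loop (step e p₁) e′ s p₂ s-simple refl)
  ... | inj₁ p-simple with a ∈ᵥ? p
  ...   | no a∉p = inj₁ (step a∉p p-simple)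
  ...   | yes a∈p with splitAt p a∈p
  ...     | s , t , refl = inj₂ (loop here e s t (Simple-++ˡ s t p-simple) refl)

  closing-cycle : g a b ≡ true → (s : Reach g b a) → Simple s → 2 ≤ length s →
                  Cycle g (suc (length s))
  closing-cycle {a} {b} e s s-simple 2≤len = record
    { order≥3 = s≤s 2≤len
    ; vtx     = vertex s
    ; vtx-inj = Simple-injective s-simple
    ; adj     = consecutive
    }
    where
    consecutive : ∀ i → g (vertex s i) (vertex s (next i)) ≡ true
    consecutive i with view i
    ... | ‵fromℕ = subst₂ (λ u v → g u v ≡ true)
                     (sym (vertex-last s))
                     (trans (sym (vertex-zero s)) (cong (vertex s) (sym (next-fromℕ _)))) e
    ... | ‵inject₁ j = subst (λ v → g (vertex s (inject₁ j)) v ≡ true)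
                         (cong (vertex s) (sym (next-inject₁ j))) (vertex-step s j)

  walkAlong : ∀ {t} (f : Fin (suc t) → Fin m) → (∀ i → g (f (inject₁ i)) (f (suc i)) ≡ true) →
              Reach g (f zero) (f (fromℕ t))
  walkAlong {zero}  f edges = here
  walkAlong {suc t} f edges = step (edges zero) (walkAlong (f ∘ suc) (edges ∘ suc))

  ∈ᵥ-walkAlong : ∀ {t} (f : Fin (suc t) → Fin m)
                 (edges : ∀ i → g (f (inject₁ i)) (f (suc i)) ≡ true) →
                 x ∈ᵥ walkAlong f edges → ∃ λ i → f i ≡ x
  ∈ᵥ-walkAlong {t = zero}  f edges (zero , eq)  = zero , eq
  ∈ᵥ-walkAlong {t = suc t} f edges (zero , eq)  = zero , eq
  ∈ᵥ-walkAlong {t = suc t} f edges (suc i , eq) =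
    let i′ , eq′ = ∈ᵥ-walkAlong (f ∘ suc) (edges ∘ suc) (i , eq) in suc i′ , eq′

module Gain {c ℓ} (𝔾 : Group c ℓ) {m} (g : SimpleGraph m) where

  open Group 𝔾 renaming (refl to ≈-refl; sym to ≈-sym; trans to ≈-trans)
  open import Algebra.Properties.Group 𝔾 using (ε⁻¹≈ε; ⁻¹-anti-homo-∙; x∙y⁻¹≈ε⇒x≈y)
  open import Relation.Binary.Reasoning.Setoid setoid
  open Walk g

  private variable a b d : Fin m

  Gains : Set c
  Gains = Fin m → Fin m → Carrier

  Antisymmetric : Gains → Set ℓ
  Antisymmetric γ = ∀ j k → γ k j ≈ γ j k ⁻¹

  gain : Gains → Reach g a b → Carrier
  gain γ here               = ε
  gain γ (step {j} {k} _ p) = γ j k ∙ gain γ p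

  gain-++ : ∀ γ (p : Reach g a b) (q : Reach g b d) → gain γ (p ++ q) ≈ gain γ p ∙ gain γ q
  gain-++ γ here               q = ≈-sym (identityˡ _)
  gain-++ γ (step {j} {k} _ p) q = begin
    γ j k ∙ gain γ (p ++ q)        ≈⟨ ∙-congˡ (gain-++ γ p q) ⟩
    γ j k ∙ (gain γ p ∙ gain γ q)  ≈⟨ assoc _ _ _ ⟨
    (γ j k ∙ gain γ p) ∙ gain γ q  ∎

  gain-reverse : ∀ {γ} (g-sym : Symmetric g) → Antisymmetric γ → (p : Reach g a b) →
                 gain γ (reverse g-sym p) ≈ gain γ p ⁻¹
  gain-reverse         g-sym anti here               = ≈-sym ε⁻¹≈ε
  gain-reverse {γ = γ} g-sym anti (step {j} {k} e p) = begin
    gain γ (reverse g-sym p ++ step _ here)  ≈⟨ gain-++ γ (reverse g-sym p) (step _ here) ⟩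
    gain γ (reverse g-sym p) ∙ (γ k j ∙ ε)   ≈⟨ ∙-cong (gain-reverse g-sym anti p) (identityʳ _) ⟩
    gain γ p ⁻¹ ∙ γ k j                      ≈⟨ ∙-congˡ (anti j k) ⟩
    gain γ p ⁻¹ ∙ γ j k ⁻¹                   ≈⟨ ⁻¹-anti-homo-∙ _ _ ⟨
    (γ j k ∙ gain γ p) ⁻¹                    ∎

  gain-ε : ∀ {γ} (p : Reach g a b) → (∀ {j k} → j ∈ᵥ p → k ∈ᵥ p → γ j k ≈ ε) → gain γ p ≈ ε
  gain-ε         here               trivial = ≈-refl
  gain-ε {γ = γ} (step {j} {k} _ p) trivial = begin
    γ j k ∙ gain γ p  ≈⟨ ∙-cong (trivial (zero , refl) (suc zero , vertex-zero p))
                                (gain-ε p inner) ⟩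
    ε ∙ ε             ≈⟨ identityˡ ε ⟩
    ε                 ∎
    where
    inner : ∀ {j k} → j ∈ᵥ p → k ∈ᵥ p → _
    inner (i , eq) (i′ , eq′) = trivial (suc i , eq) (suc i′ , eq′)

  -- A closed walk contains a simple loop. In an irreflexive acyclic graph that loop
  -- is a backtrack j → k → j, whose gain cancels, and removing it shortens the walk.
  closed-walk-gain : ∀ {γ} → Irreflexive g → Acyclic g → Antisymmetric γ →
                     (p : Reach g a a) → gain γ p ≈ ε
  closed-walk-gain {γ = γ} irreflexive acyclic anti p = bounded (length p) p ≤-refl
    where
    backtrack : ∀ j k x → γ j k ∙ (γ k j ∙ x) ≈ x
    backtrack j k x = begin
      γ j k ∙ (γ k j ∙ x)       ≈⟨ ∙-congˡ (∙-congʳ (anti j k)) ⟩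
      γ j k ∙ (γ j k ⁻¹ ∙ x)    ≈⟨ assoc _ _ _ ⟨
      (γ j k ∙ γ j k ⁻¹) ∙ x    ≈⟨ ∙-congʳ (inverseʳ _) ⟩
      ε ∙ x                     ≈⟨ identityˡ x ⟩
      x                         ∎

    shorter : ∀ {n} (p₁ : Reach g a b) (p₂ : Reach g b a) (e : g b d ≡ true) (e′ : g d b ≡ true) →
              length (p₁ ++ step e (step e′ p₂)) ≤ suc n → length (p₁ ++ p₂) ≤ n
    shorter p₁ p₂ e e′ len≤
      rewrite length-++ p₁ (step e (step e′ p₂)) | +-suc (length p₁) (suc (length p₂))
            | +-suc (length p₁) (length p₂) | length-++ p₁ p₂ with len≤
    ... | s≤s len≤′ = ≤-trans (n≤1+n _) len≤′

    simple-closed : (p : Reach g a a) → Simple p → gain γ p ≈ ε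
    simple-closed here       _            = ≈-refl
    simple-closed (step _ p) (step a∉p _) = ⊥-elim (a∉p (_ , vertex-last p))

    bounded : ∀ n {a} (p : Reach g a a) → length p ≤ n → gain γ p ≈ ε
    bounded zero    here _ = ≈-refl
    bounded (suc n) p len≤ with simple-or-loop p
    bounded (suc n) p _ | inj₁ p-simple = simple-closed p p-simple
    bounded (suc n) _ _ | inj₂ (loop {y} _ e here _ _ refl)
      with () ← trans (sym e) (irreflexive y)
    bounded (suc n) _ len≤ | inj₂ (loop {y} {z} p₁ e (step e′ here) p₂ _ refl) = begin
      gain γ (p₁ ++ step e (step e′ p₂))           ≈⟨ gain-++ γ p₁ _ ⟩
      gain γ p₁ ∙ (γ y z ∙ (γ z y ∙ gain γ p₂))    ≈⟨ ∙-congˡ (backtrack y z _) ⟩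
      gain γ p₁ ∙ gain γ p₂                        ≈⟨ gain-++ γ p₁ p₂ ⟨
      gain γ (p₁ ++ p₂)                            ≈⟨ bounded n (p₁ ++ p₂) (shorter p₁ p₂ e e′ len≤) ⟩
      ε                                            ∎
    bounded (suc n) _ _ | inj₂ (loop p₁ e s@(step _ (step _ _)) p₂ s-simple refl) =
      ⊥-elim (acyclic (closing-cycle e s s-simple (s≤s (s≤s z≤n))))

  module Potential (g-sym : Symmetric g) {γ} (anti : Antisymmetric γ)
                   (closed : ∀ {a} (p : Reach g a a) → gain γ p ≈ ε)
                   {r} (reach : ∀ j → Reach g r j) where

    potential : Fin m → Carrier
    potential j = gain γ (reach j)

    potential-walk : (p : Reach g r a) → potential a ≈ gain γ p
    potential-walk {a} p = x∙y⁻¹≈ε⇒x≈y _ _ (begin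
      potential a ∙ gain γ p ⁻¹               ≈⟨ ∙-congˡ (gain-reverse g-sym anti p) ⟨
      potential a ∙ gain γ (reverse g-sym p)  ≈⟨ gain-++ γ (reach a) (reverse g-sym p) ⟨
      gain γ (reach a ++ reverse g-sym p)     ≈⟨ closed (reach a ++ reverse g-sym p) ⟩
      ε                                       ∎)

    potential-edge : g a b ≡ true → potential b ≈ potential a ∙ γ a b
    potential-edge {a} {b} e = begin
      potential b                      ≈⟨ potential-walk (reach a ++ step e here) ⟩
      gain γ (reach a ++ step e here)  ≈⟨ gain-++ γ (reach a) (step e here) ⟩
      potential a ∙ (γ a b ∙ ε)        ≈⟨ ∙-congˡ (identityʳ _) ⟩
      potential a ∙ γ a b              ∎

module AbelianGain {c ℓ} (𝔸 : AbelianGroup c ℓ) {m} (g : SimpleGraph m) where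

  open AbelianGroup 𝔸 renaming (sym to ≈-sym; trans to ≈-trans)
  open import Algebra.Properties.CommutativeSemigroup commutativeSemigroup using (interchange)
  open Gain group g

  gain-∙ : ∀ γ δ {a b} (p : Reach g a b) → gain (λ j k → γ j k ∙ δ j k) p ≈ gain γ p ∙ gain δ p
  gain-∙ γ δ here       = ≈-sym (identityˡ ε)
  gain-∙ γ δ (step _ p) = ≈-trans (∙-congˡ (gain-∙ γ δ p)) (interchange _ _ _ _)

Edge : ∀ {m} → Fin m → Fin m → Fin m → Fin m → Set
Edge u v j k = (j ≡ u × k ≡ v) ⊎ (k ≡ u × j ≡ v)

Edge? : ∀ {m} (u v j k : Fin m) → Dec (Edge u v j k)
Edge? u v j k = (j ≟ᶠ u ×-dec k ≟ᶠ v) ⊎-dec (k ≟ᶠ u ×-dec j ≟ᶠ v)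

Edge-flip : ∀ {m} {u v j k : Fin m} → Edge u v j k → Edge j k u v
Edge-flip (inj₁ (refl , refl)) = inj₁ (refl , refl)
Edge-flip (inj₂ (refl , refl)) = inj₂ (refl , refl)

withoutEdge : ∀ {m} → SimpleGraph m → Fin m → Fin m → SimpleGraph m
withoutEdge g u v j k with Edge? u v j k
... | yes _ = false
... | no _  = g j k

module _ {m} {g : SimpleGraph m} {u v : Fin m} where

  withoutEdge-⊆ : ∀ {j k} → withoutEdge g u v j k ≡ true → g j k ≡ true
  withoutEdge-⊆ {j} {k} e with Edge? u v j k
  ... | no _ = e

  withoutEdge-∉ : ∀ {j k} → withoutEdge g u v j k ≡ true → ¬ Edge u v j k
  withoutEdge-∉ {j} {k} e with Edge? u v j k
  ... | no uv∉ = uv∉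

  withoutEdge-intro : ∀ {j k} → g j k ≡ true → ¬ Edge u v j k → withoutEdge g u v j k ≡ true
  withoutEdge-intro {j} {k} e uv∉ with Edge? u v j k
  ... | yes uv = ⊥-elim (uv∉ uv)
  ... | no _   = e

  withoutEdge-split : ∀ {j k} → g j k ≡ true → withoutEdge g u v j k ≡ true ⊎ Edge u v j k
  withoutEdge-split {j} {k} e with Edge? u v j k
  ... | yes uv = inj₂ uv
  ... | no _   = inj₁ e

  withoutEdge-symmetric : Symmetric g → Symmetric (withoutEdge g u v)
  withoutEdge-symmetric g-sym j k with Edge? u v j k | Edge? u v k j
  ... | yes _  | yes _  = refl
  ... | yes uv | no uv∉ = ⊥-elim (uv∉ (swap uv))
  ... | no uv∉ | yes uv = ⊥-elim (uv∉ (swap uv))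
  ... | no _   | no _   = g-sym j k

  withoutEdge-irreflexive : Irreflexive g → Irreflexive (withoutEdge g u v)
  withoutEdge-irreflexive g-irr j with Edge? u v j j
  ... | yes _ = refl
  ... | no _  = g-irr j

  withoutEdge-reach : Symmetric g → Reach (withoutEdge g u v) u v →
                      ∀ {j k} → Reach g j k → Reach (withoutEdge g u v) j k
  withoutEdge-reach g-sym bridge here = here
  withoutEdge-reach g-sym bridge (step {j} {k} e p) with Edge? u v j k
  ... | yes (inj₁ (refl , refl)) = bridge ++ withoutEdge-reach g-sym bridge p
    where open Walk (withoutEdge g u v)
  ... | yes (inj₂ (refl , refl)) =
    reverse (withoutEdge-symmetric g-sym) bridge ++ withoutEdge-reach g-sym bridge p
    where open Walk (withoutEdge g u v)
  ... | no uv∉ = step (withoutEdge-intro e uv∉) (withoutEdge-reach g-sym bridge p)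

cycleEdge-shared : ∀ {m} {g : SimpleGraph m} → Unicyclic g →
                   ∀ {n n′} (C : Cycle g n) (C′ : Cycle g n′) {j k} → CycleEdge C j k → CycleEdge C′ j k
cycleEdge-shared (_ , _ , _ , same) C C′ jk =
  Equivalence.to (same _ C′ _ _) (Equivalence.from (same _ C _ _) jk)

withoutCycleEdge-acyclic : ∀ {m} {g : SimpleGraph m} → Unicyclic g → ∀ {n} (C : Cycle g n) →
                           ∀ {u v} → CycleEdge C u v → Acyclic (withoutEdge g u v)
withoutCycleEdge-acyclic {g = g} unicyclic C {u} {v} uv C′
  with i , uv′ ← cycleEdge-shared unicyclic C (Cycle-mono (withoutEdge-⊆ {g = g} {u} {v}) C′) uv
  = withoutEdge-∉ {g = g} (adj C′ i) (Edge-flip uv′)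


kindGain : EdgeKind → U4
kindGain none  = one
kindGain undir = one
kindGain out   = ii
kindGain into  = mii

kindGain-flip : ∀ e → kindGain (flipKind e) ≡ inv (kindGain e)
kindGain-flip none  = refl
kindGain-flip undir = refl
kindGain-flip out   = refl
kindGain-flip into  = refl

isEdge-flip : ∀ e → isEdge (flipKind e) ≡ isEdge e
isEdge-flip none  = refl
isEdge-flip undir = refl
isEdge-flip out   = refl
isEdge-flip into  = refl

weight : ∀ {m} → MixedGraph m → Fin m → Fin m → U4
weight X j k = kindGain (kind X j k)

weight-antisym : ∀ {m} (X : MixedGraph m) j k → weight X k j ≡ inv (weight X j k)
weight-antisym X j k = trans (cong kindGain (consistent X j k)) (kindGain-flip (kind X j k))

G-symmetric : ∀ {m} (X : MixedGraph m) → Symmetric (G X)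
G-symmetric X j k = trans (sym (isEdge-flip (kind X j k))) (cong isEdge (sym (consistent X j k)))

G-irreflexive : ∀ {m} (X : MixedGraph m) → Irreflexive (G X)
G-irreflexive X j = cong isEdge (loopless X j)

-- The value -1 is not the weight of an edge; it is sent to undir only to make orient total.
orient : U4 → EdgeKind
orient one  = undir
orient ii   = out
orient mone = undir
orient mii  = into

orient-inv : ∀ u → orient (inv u) ≡ flipKind (orient u)
orient-inv one  = refl
orient-inv ii   = refl
orient-inv mone = refl
orient-inv mii  = refl

DirectedKind : EdgeKind → Set
DirectedKind e = e ≡ out ⊎ e ≡ into

orient-directed : ∀ u → DirectedKind (orient u) → Directional u
orient-directed one  (inj₁ ())
orient-directed one  (inj₂ ())
orient-directed ii   _ = inj₁ refl
orient-directed mone (inj₁ ())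
orient-directed mone (inj₂ ())
orient-directed mii  _ = inj₂ refl

directional-orient : ∀ {u} → Directional u → DirectedKind (orient u)
directional-orient (inj₁ refl) = inj₁ refl
directional-orient (inj₂ refl) = inj₂ refl

reorient : EdgeKind → U4 → EdgeKind
reorient none _ = none
reorient _    u = orient u

reorient-edge : ∀ {e} u → isEdge e ≡ true → reorient e u ≡ orient u
reorient-edge {undir} _ _ = refl
reorient-edge {out}   _ _ = refl
reorient-edge {into}  _ _ = refl

orient-isEdge : ∀ u → isEdge (orient u) ≡ true
orient-isEdge one  = refl
orient-isEdge ii   = refl
orient-isEdge mone = refl
orient-isEdge mii  = refl

reorient-isEdge : ∀ e u → isEdge (reorient e u) ≡ isEdge e
reorient-isEdge none  _ = refl
reorient-isEdge undir u = orient-isEdge u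
reorient-isEdge out   u = orient-isEdge u
reorient-isEdge into  u = orient-isEdge u

reorient-flip : ∀ e u → reorient (flipKind e) (inv u) ≡ flipKind (reorient e u)
reorient-flip none  _ = refl
reorient-flip undir u = orient-inv u
reorient-flip out   u = orient-inv u
reorient-flip into  u = orient-inv u

reorient-directed : ∀ e u → DirectedKind (reorient e u) → isEdge e ≡ true × Directional u
reorient-directed none  _ (inj₁ ())
reorient-directed none  _ (inj₂ ())
reorient-directed undir u dir = refl , orient-directed u dir
reorient-directed out   u dir = refl , orient-directed u dir
reorient-directed into  u dir = refl , orient-directed u dir

entry : EdgeKind → Entry
entry none = zero
entry e    = unit (kindGain e)

H-entry : ∀ {m} (X : MixedGraph m) j k → H X j k ≡ entry (kind X j k)
H-entry X j k with kind X j k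
... | none  = refl
... | undir = refl
... | out   = refl
... | into  = refl

entry-orient : ∀ u → u ≢ mone → entry (orient u) ≡ unit u
entry-orient one  _  = refl
entry-orient ii   _  = refl
entry-orient mone ne = ⊥-elim (ne refl)
entry-orient mii  _  = refl

unswitch : ∀ a u b → (inv a · ((a · u) · inv b)) · b ≡ u
unswitch = from-yes (∀ᵤ? λ a → ∀ᵤ? λ u → ∀ᵤ? λ b → (inv a · ((a · u) · inv b)) · b ≟ᵤ u)

switch-unit : ∀ e a b → (a · kindGain e) · inv b ≢ mone →
              unit (kindGain e) ≡ sandwich (inv a) (entry (orient ((a · kindGain e) · inv b))) b
switch-unit e a b ok = trans (cong unit (sym (unswitch a (kindGain e) b)))
                             (cong (λ t → sandwich (inv a) t b) (sym (entry-orient _ ok)))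

switch-entry : ∀ e a b → (isEdge e ≡ true → (a · kindGain e) · inv b ≢ mone) →
               entry e ≡ sandwich (inv a) (entry (reorient e ((a · kindGain e) · inv b))) b
switch-entry none  _ _ _  = refl
switch-entry undir a b ok = switch-unit undir a b (ok refl)
switch-entry out   a b ok = switch-unit out a b (ok refl)
switch-entry into  a b ok = switch-unit into a b (ok refl)

module Switching {m} (X : MixedGraph m) (d : Fin m → U4) where

  shift : Fin m → Fin m → U4
  shift j k = (d j · weight X j k) · inv (d k)

  shift-antisym : ∀ j k → shift k j ≡ inv (shift j k)
  shift-antisym j k = trans (cong (λ w → (d k · w) · inv (d j)) (weight-antisym X j k))
                            (flipped (d j) (weight X j k) (d k))
    where
    flipped : ∀ a u b → (b · inv u) · inv a ≡ inv ((a · u) · inv b)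
    flipped = from-yes (∀ᵤ? λ a → ∀ᵤ? λ u → ∀ᵤ? λ b → (b · inv u) · inv a ≟ᵤ inv ((a · u) · inv b))

  switched : MixedGraph m
  switched = record
    { kind       = λ j k → reorient (kind X j k) (shift j k)
    ; loopless   = λ j → cong (λ e → reorient e (shift j j)) (loopless X j)
    ; consistent = λ j k → trans (cong₂ reorient (consistent X j k) (shift-antisym j k))
                                 (reorient-flip (kind X j k) (shift j k))
    }

  G-switched : ∀ j k → G switched j k ≡ G X j k
  G-switched j k = reorient-isEdge (kind X j k) (shift j k)

  switched-equivalent : (∀ j k → G X j k ≡ true → shift j k ≢ mone) → SwitchingEquivalent X switched
  switched-equivalent admissible = d , λ j k → begin
    H X j k
      ≡⟨ H-entry X j k ⟩
    entry (kind X j k)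
      ≡⟨ switch-entry (kind X j k) (d j) (d k) (admissible j k) ⟩
    sandwich (inv (d j)) (entry (kind switched j k)) (d k)
      ≡⟨ cong (λ t → sandwich (inv (d j)) t (d k)) (H-entry switched j k) ⟨
    sandwich (inv (d j)) (H switched j k) (d k)
      ∎
    where open ≡-Reasoning

  switched-directed : ∀ j k → Directed switched j k ⇔ (G X j k ≡ true × Directional (shift j k))
  switched-directed j k = mk⇔ (reorient-directed (kind X j k) (shift j k))
    λ (edge , dir) →
      subst DirectedKind (sym (reorient-edge (shift j k) edge)) (directional-orient dir)

  switched-out : ∀ {j k} → G X j k ≡ true → shift j k ≡ ii → kind switched j k ≡ out
  switched-out {j} {k} edge eq = trans (reorient-edge (shift j k) edge) (cong orient eq)

twist : ∀ {m} → Fin m → Fin m → U4 → Fin m → Fin m → U4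
twist u v s j k with j ≟ᶠ u ×-dec k ≟ᶠ v | j ≟ᶠ v ×-dec k ≟ᶠ u
... | yes _ | _     = s
... | no _  | yes _ = inv s
... | no _  | no _  = one

module _ {m} {u v : Fin m} {s : U4} where

  twist-at : twist u v s u v ≡ s
  twist-at with u ≟ᶠ u ×-dec v ≟ᶠ v | u ≟ᶠ v ×-dec v ≟ᶠ u
  ... | yes _ | _ = refl
  ... | no ¬uv | _ = ⊥-elim (¬uv (refl , refl))

  twist-antisym : u ≢ v → ∀ j k → twist u v s k j ≡ inv (twist u v s j k)
  twist-antisym u≢v j k
    with k ≟ᶠ u ×-dec j ≟ᶠ v | k ≟ᶠ v ×-dec j ≟ᶠ u | j ≟ᶠ u ×-dec k ≟ᶠ v | j ≟ᶠ v ×-dec k ≟ᶠ u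
  ... | yes (_ , refl) | _ | yes (refl , _) | _ = ⊥-elim (u≢v refl)
  ... | yes _ | _ | no _ | yes _ = sym (⁻¹-involutive s)
  ... | yes (k≡u , j≡v) | _ | no _ | no ¬vu = ⊥-elim (¬vu (j≡v , k≡u))
  ... | no _ | yes _ | yes _ | _ = refl
  ... | no _ | yes (k≡v , j≡u) | no ¬uv | _ = ⊥-elim (¬uv (j≡u , k≡v))
  ... | no ¬uv′ | no _ | _ | yes (j≡v , k≡u) = ⊥-elim (¬uv′ (k≡u , j≡v))
  ... | no _ | no ¬vu′ | yes (j≡u , k≡v) | _ = ⊥-elim (¬vu′ (k≡v , j≡u))
  ... | no _ | no _ | no _ | no _ = refl

  twist-away : ∀ {j k} → j ≢ u → k ≢ u → twist u v s j k ≡ one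
  twist-away {j} {k} j≢u k≢u with j ≟ᶠ u ×-dec k ≟ᶠ v | j ≟ᶠ v ×-dec k ≟ᶠ u
  ... | yes (j≡u , _) | _ = ⊥-elim (j≢u j≡u)
  ... | no _ | yes (_ , k≡u) = ⊥-elim (k≢u k≡u)
  ... | no _ | no _ = refl

  twist-support : ∀ {j k} → twist u v s j k ≢ one → Edge u v j k
  twist-support {j} {k} nontrivial with j ≟ᶠ u ×-dec k ≟ᶠ v | j ≟ᶠ v ×-dec k ≟ᶠ u
  ... | yes uv | _ = inj₁ uv
  ... | no _ | yes (j≡v , k≡u) = inj₂ (k≡u , j≡v)
  ... | no _ | no _ = ⊥-elim (nontrivial refl)

  twist-values : ∀ j k → twist u v s j k ≡ s ⊎ twist u v s j k ≡ inv s ⊎ twist u v s j k ≡ one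
  twist-values j k with j ≟ᶠ u ×-dec k ≟ᶠ v | j ≟ᶠ v ×-dec k ≟ᶠ u
  ... | yes _ | _ = inj₁ refl
  ... | no _ | yes _ = inj₂ (inj₁ refl)
  ... | no _ | no _ = inj₂ (inj₂ refl)

twist-one : ∀ {m} {u v : Fin m} j k → twist u v one j k ≡ one
twist-one {u = u} {v} j k with j ≟ᶠ u ×-dec k ≟ᶠ v | j ≟ᶠ v ×-dec k ≟ᶠ u
... | yes _ | _ = refl
... | no _ | yes _ = refl
... | no _ | no _ = refl

Undirected : ∀ {m} → MixedGraph m → Set
Undirected Y = ∀ j k → Directed Y j k → ⊥

OnlyCycleEdgeDirected : ∀ {m} {g : SimpleGraph m} {n} → Cycle g n → MixedGraph m → Set
OnlyCycleEdgeDirected C Y = ∃ λ i → ∀ j k → (Directed Y j k ⇔ OnEdge C i j k)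

ConsecutiveDirected : ∀ {m} → MixedGraph m → Fin m → Fin m → Fin m → Set
ConsecutiveDirected Y a b c =
  ((kind Y a b ≡ out × kind Y b c ≡ out) ⊎ (kind Y a b ≡ into × kind Y b c ≡ into))
  × (∀ j k → Directed Y j k → Edge a b j k ⊎ Edge b c j k)

ConsecutiveCycleEdgesDirected : ∀ {m} {g : SimpleGraph m} {n} → Cycle g n → MixedGraph m → Set
ConsecutiveCycleEdgesDirected C Y =
  ∃ λ i → ConsecutiveDirected Y (vtx C i) (vtx C (next i)) (vtx C (next (next i)))

NormalForm : ∀ {m} (X : MixedGraph m) {n} → Cycle (G X) n → Set
NormalForm {m} X C = Σ (MixedGraph m) λ Y →
  (∀ j k → G Y j k ≡ G X j k) × SwitchingEquivalent X Y ×
  (Undirected Y ⊎ OnlyCycleEdgeDirected C Y ⊎ ConsecutiveCycleEdgesDirected C Y)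

module Normalisation {m} (X : MixedGraph m) (unicyclic : Unicyclic (G X))
                     {k} (C : Cycle (G X) (3 + k)) where

  -- The cycle runs B = c 0, B₁ = c 1, …, A = c i₀ and back to B. Removing its edge A B
  -- leaves the spanning tree T, and arc is the rest of the cycle, from B to A inside T.
  c : Fin (3 + k) → Fin m
  c = vtx C

  i₀ : Fin (3 + k)
  i₀ = fromℕ (2 + k)

  A B B₁ : Fin m
  A  = c i₀
  B  = c zero
  B₁ = c (suc zero)

  B≡next : B ≡ c (next i₀)
  B≡next = cong c (sym (next-fromℕ (2 + k)))

  B₁≡next² : B₁ ≡ c (next (next i₀))
  B₁≡next² = cong c (sym (trans (cong next (next-fromℕ (2 + k))) (next-inject₁ zero)))

  B≢B₁ : B ≢ B₁
  B≢B₁ eq with () ← vtx-inj C eq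

  AB-edge : G X A B ≡ true
  AB-edge = subst (λ b → G X A b ≡ true) (sym B≡next) (adj C i₀)

  T : SimpleGraph m
  T = withoutEdge (G X) A B

  T-symmetric : Symmetric T
  T-symmetric = withoutEdge-symmetric (G-symmetric X)

  T-acyclic : Acyclic T
  T-acyclic = withoutCycleEdge-acyclic unicyclic C (i₀ , inj₁ (refl , B≡next))

  arc-edge : ∀ i → T (c (inject₁ i)) (c (suc i)) ≡ true
  arc-edge i = withoutEdge-intro {g = G X}
    (subst (λ i′ → G X (c (inject₁ i)) (c i′) ≡ true) (next-inject₁ i) (adj C (inject₁ i)))
    (off-AB i)
    where
    off-AB : ∀ i → ¬ Edge A B (c (inject₁ i)) (c (suc i))
    off-AB i       (inj₁ (eq , _)) = fromℕ≢inject₁ (sym (vtx-inj C eq))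
    off-AB zero    (inj₂ (eq , _)) with () ← suc-injective (vtx-inj C eq)
    off-AB (suc i) (inj₂ (_ , eq)) with () ← vtx-inj C eq

  open Walk T
  open Gain (AbelianGroup.group U4-abelianGroup) T
  open AbelianGain U4-abelianGroup T

  arc : Reach T B A
  arc = walkAlong c arc-edge

  reach : ∀ j → Reach T B j
  reach j = withoutEdge-reach (G-symmetric X) (reverse T-symmetric arc) (proj₁ unicyclic B j)

  ω : Fin m → Fin m → U4
  ω = weight X

  W : U4
  W = gain ω arc · ω A B

  σ : U4 → Fin m → Fin m → U4
  σ s = twist B B₁ s

  γ : U4 → Fin m → Fin m → U4
  γ s j k = ω j k · σ s j k

  γ-antisym : ∀ s → Antisymmetric (γ s)
  γ-antisym s j k = trans (cong₂ _·_ (weight-antisym X j k) (twist-antisym B≢B₁ j k))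
                          (⁻¹-∙-comm (ω j k) (σ s j k))

  T-closed-walk : ∀ s {a} (p : Reach T a a) → gain (γ s) p ≡ one
  T-closed-walk s =
    closed-walk-gain (withoutEdge-irreflexive (G-irreflexive X)) T-acyclic (γ-antisym s)

  module P (s : U4) = Potential T-symmetric (γ-antisym s) (T-closed-walk s) reach
  module Y (s : U4) = Switching X (P.potential s)

  shift-tree : ∀ s {j k} → T j k ≡ true → Y.shift s j k ≡ inv (σ s j k)
  shift-tree s {j} {k} e = trans (cong (λ t → (d j · ω j k) · inv t) (P.potential-edge s e))
                                 (cancel (d j) (ω j k) (σ s j k))
    where
    d : Fin m → U4
    d = P.potential s
    cancel : ∀ a w t → (a · w) · inv (a · (w · t)) ≡ inv t
    cancel = from-yes (∀ᵤ? λ a → ∀ᵤ? λ w → ∀ᵤ? λ t → (a · w) · inv (a · (w · t)) ≟ᵤ inv t)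

  arc-twist : ∀ s → gain (σ s) arc ≡ s
  arc-twist s =
    trans (cong₂ _·_ (twist-at {u = B} {B₁})
                     (gain-ε rest λ j∈ k∈ → twist-away {v = B₁} (off-B j∈) (off-B k∈)))
          (·-identityʳ s)
    where
    rest : Reach T B₁ A
    rest = walkAlong (c ∘ suc) (arc-edge ∘ suc)
    off-B : ∀ {j} → j ∈ᵥ rest → j ≢ B
    off-B j∈ refl with i , eq ← ∈ᵥ-walkAlong (c ∘ suc) (arc-edge ∘ suc) j∈
      with () ← vtx-inj C eq

  shift-AB : ∀ s → Y.shift s A B ≡ W · s
  shift-AB s = begin
    (d A · ω A B) · inv (d B)
      ≡⟨ cong₂ (λ p q → (p · ω A B) · inv q) (P.potential-walk s arc) (P.potential-walk s here) ⟩
    (gain (γ s) arc · ω A B) · inv one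
      ≡⟨ cong (λ p → (p · ω A B) · inv one) (gain-∙ ω (σ s) arc) ⟩
    ((gain ω arc · gain (σ s) arc) · ω A B) · inv one
      ≡⟨ cong (λ t → ((gain ω arc · t) · ω A B) · inv one) (arc-twist s) ⟩
    ((gain ω arc · s) · ω A B) · inv one
      ≡⟨ rearrange (gain ω arc) s (ω A B) ⟩
    W · s
      ∎
    where
    open ≡-Reasoning
    d : Fin m → U4
    d = P.potential s
    rearrange : ∀ p s q → ((p · s) · q) · inv one ≡ (p · q) · s
    rearrange = from-yes (∀ᵤ? λ p → ∀ᵤ? λ s → ∀ᵤ? λ q → ((p · s) · q) · inv one ≟ᵤ (p · q) · s)

  data ShiftOnEdge (s : U4) (j k : Fin m) : Set where
    tree     : T j k ≡ true → Y.shift s j k ≡ inv (σ s j k) → ShiftOnEdge s j k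
    forward  : j ≡ A → k ≡ B → Y.shift s j k ≡ W · s → ShiftOnEdge s j k
    backward : k ≡ A → j ≡ B → Y.shift s j k ≡ inv (W · s) → ShiftOnEdge s j k

  shift-on-edge : ∀ s {j k} → G X j k ≡ true → ShiftOnEdge s j k
  shift-on-edge s e with withoutEdge-split {g = G X} e
  ... | inj₁ t                    = tree t (shift-tree s t)
  ... | inj₂ (inj₁ (refl , refl)) = forward refl refl (shift-AB s)
  ... | inj₂ (inj₂ (refl , refl)) =
    backward refl refl (trans (Y.shift-antisym s A B) (cong inv (shift-AB s)))

  admissible : ∀ s → (∀ j k → inv (σ s j k) ≢ mone) → W · s ≢ mone →
               ∀ j k → G X j k ≡ true → Y.shift s j k ≢ mone
  admissible s tree-ok AB-ok j k e eq with shift-on-edge s e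
  ... | tree _ eq′       = tree-ok j k (trans (sym eq′) eq)
  ... | forward _ _ eq′  = AB-ok (trans (sym eq′) eq)
  ... | backward _ _ eq′ = AB-ok (⁻¹-injective (trans (sym eq′) eq))

  inv-σ-one : ∀ j k → inv (σ one j k) ≡ one
  inv-σ-one j k = cong inv (twist-one j k)

  undirected : W ≡ one → NormalForm X C
  undirected W≡one = Y.switched one , Y.G-switched one ,
    Y.switched-equivalent one (λ j k e eq → one≢mone (trans (sym (trivial e)) eq)) ,
    inj₁ λ j k dir → let e , d = Equivalence.to (Y.switched-directed one j k) dir
                     in ¬Directional-one (subst Directional (trivial e) d)
    where
    trivial : ∀ {j k} → G X j k ≡ true → Y.shift one j k ≡ one
    trivial {j} {k} e with shift-on-edge one e
    ... | tree _ eq       = trans eq (inv-σ-one j k)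
    ... | forward _ _ eq  = trans eq (cong (_· one) W≡one)
    ... | backward _ _ eq = trans eq (cong (λ w → inv (w · one)) W≡one)

  directed-edge : ∀ s {j k} → Directed (Y.switched s) j k →
                  (T j k ≡ true × Directional (inv (σ s j k))) ⊎ Edge A B j k
  directed-edge s {j} {k} dir with e , d ← Equivalence.to (Y.switched-directed s j k) dir
    with shift-on-edge s e
  ... | tree t eq           = inj₁ (t , subst Directional eq d)
  ... | forward j≡A k≡B _  = inj₂ (inj₁ (j≡A , k≡B))
  ... | backward k≡A j≡B _ = inj₂ (inj₂ (k≡A , j≡B))

  oneDirected : Directional W → NormalForm X C
  oneDirected W-dir = Y.switched one , Y.G-switched one ,
    Y.switched-equivalent one
      (admissible one (λ j k eq → one≢mone (trans (sym (inv-σ-one j k)) eq))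
                      (directional≢mone (subst Directional (sym (·-identityʳ W)) W-dir))) ,
    inj₂ (inj₁ (i₀ , subst (λ b → ∀ j k → Directed (Y.switched one) j k ⇔ Edge A b j k) B≡next
                           (λ j k → mk⇔ to from)))
    where
    to : ∀ {j k} → Directed (Y.switched one) j k → Edge A B j k
    to {j} {k} dir with directed-edge one dir
    ... | inj₁ (_ , d) = ⊥-elim (¬Directional-one (subst Directional (inv-σ-one j k) d))
    ... | inj₂ AB      = AB
    from : ∀ {j k} → Edge A B j k → Directed (Y.switched one) j k
    shift-AB≡W : Y.shift one A B ≡ W
    shift-AB≡W = trans (shift-AB one) (·-identityʳ W)
    from (inj₁ (refl , refl)) = Equivalence.from (Y.switched-directed one A B)
      (AB-edge , subst Directional (sym shift-AB≡W) W-dir)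
    from (inj₂ (refl , refl)) = Equivalence.from (Y.switched-directed one B A)
      (trans (G-symmetric X B A) AB-edge ,
       subst Directional (sym (trans (Y.shift-antisym one A B) (cong inv shift-AB≡W)))
             (Directional-inv W-dir))

  twoDirected : W ≡ mone → NormalForm X C
  twoDirected W≡mone = Y.switched mii , Y.G-switched mii ,
    Y.switched-equivalent mii (admissible mii tree-ok (directional≢mone (inj₁ W·mii≡ii))) ,
    inj₂ (inj₂ (i₀ , subst₂ (ConsecutiveDirected (Y.switched mii) A) B≡next B₁≡next²
                            (inj₁ (out-AB , out-BB₁) , only)))
    where
    W·mii≡ii : W · mii ≡ ii
    W·mii≡ii = cong (_· mii) W≡mone
    tree-ok : ∀ j k → inv (σ mii j k) ≢ mone
    tree-ok j k eq with twist-values {u = B} {B₁} {mii} j k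
    ... | inj₁ σ≡        = directional≢mone (inj₁ (cong inv σ≡)) eq
    ... | inj₂ (inj₁ σ≡) = directional≢mone (inj₂ (cong inv σ≡)) eq
    ... | inj₂ (inj₂ σ≡) = one≢mone (trans (sym (cong inv σ≡)) eq)
    out-AB : kind (Y.switched mii) A B ≡ out
    out-AB = Y.switched-out mii AB-edge (trans (shift-AB mii) W·mii≡ii)
    out-BB₁ : kind (Y.switched mii) B B₁ ≡ out
    out-BB₁ = Y.switched-out mii (withoutEdge-⊆ {g = G X} (arc-edge zero))
                (trans (shift-tree mii (arc-edge zero)) (cong inv (twist-at {u = B} {B₁})))
    only : ∀ j k → Directed (Y.switched mii) j k → Edge A B j k ⊎ Edge B B₁ j k
    only j k dir with directed-edge mii dir
    ... | inj₁ (_ , d) = inj₂ (twist-support {u = B} {B₁} {mii}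
                                 λ σ≡one → ¬Directional-one (subst Directional (cong inv σ≡one) d))
    ... | inj₂ AB      = inj₁ AB

  normalForm : NormalForm X C
  normalForm with W in W≡
  ... | one  = undirected W≡
  ... | ii   = oneDirected (inj₁ W≡)
  ... | mone = twoDirected W≡
  ... | mii  = oneDirected (inj₂ W≡)

theorem2p5 : ∀ {m} (X : MixedGraph m) → Unicyclic (G X) → ∀ n (C : Cycle (G X) n) →
    Σ (MixedGraph m) λ Y →
      (∀ j k → G Y j k ≡ G X j k) × SwitchingEquivalent X Y ×
      ((∀ j k → Directed Y j k → ⊥)
       ⊎ (∃ λ i → ∀ j k → (Directed Y j k ⇔ OnEdge C i j k))
       ⊎ (∃ λ i →
            ((kind Y (vtx C i) (vtx C (next i)) ≡ out
                × kind Y (vtx C (next i)) (vtx C (next (next i))) ≡ out)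
             ⊎ (kind Y (vtx C i) (vtx C (next i)) ≡ into
                × kind Y (vtx C (next i)) (vtx C (next (next i))) ≡ into))
            × (∀ j k → Directed Y j k → OnEdge C i j k ⊎ OnEdge C (next i) j k)))
theorem2p5 X unicyclic n C with order≥3 C
... | s≤s (s≤s (s≤s _)) = Normalisation.normalForm X unicyclic C
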